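{- Let $G$ be a finite abelian group of order $n\ge 4$ and let $2\le h\le \lfloor n/2\rfloor+1$. For $a\in G$ let $f_a(h)$ denote the number of $h$-element subsets $\{x_1,\dots,x_h\}\subseteq G$ with $x_1+\cdots+x_h=a$. Then \[ \max_{a\in G} f_a(h)-\min_{a\in G} f_a(h)\le \begin{cases} \dfrac{2^{\frac34 h}}{h(h-2)(h-4)\cdots 4\cdot 2}\, n^{h/2}, & \text{if } h \text{ is even},\\[0.5cm] \dfrac{2^{\frac34 h}}{(h+1)(h-1)(h-3)\cdots 4\cdot 2}\, n^{(h+1)/2}, & \text{if } h \text{ is odd}. \end{cases} \]
   Context: $G$ is written additively. The denominators are $\prod_{j\in\{0,2,\dots,h-2\}}(h-j)$ for even $h$ and $\prod_{j\in\{0,2,\dots,h-1\}}(h+1-j)$ for odd $h$. -}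

module Defs where

open import Level using (Level)
open import Data.Nat using (ℕ; zero; suc; _+_; _*_; _⊔_; _⊓_)
open import Data.Bool using (Bool; true; false)
open import Data.Fin using (Fin)
import Data.Fin as F
open import Data.Fin.Subset using (Subset; ∣_∣)
open import Data.Vec using (Vec; []; _∷_)
open import Data.List using (List; []; _∷_; map; _++_; length; filter)
open import Algebra.Bundles using (AbelianGroup)
open import Relation.Binary.Definitions using (Decidable)
open import Relation.Nullary using (Dec; yes; no)
open import Relation.Nullary.Decidable using (_×-dec_)
open import Data.Product using (_×_)
open import Relation.Binary.PropositionalEquality using (_≡_)
import Data.Nat as N

allSubsets : (n : ℕ) → List (Subset n)
allSubsets zero = [] ∷ []
allSubsets (suc n) = map (false ∷_) (allSubsets n) ++ map (true ∷_) (allSubsets n)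

-- Double factorial: dfact 0 = dfact 1 = 1, dfact (k+2) = (k+2) * dfact k.
-- For even h: dfact h = h (h-2) ... 4 * 2; for odd h: dfact (h+1) = (h+1)(h-1)...4*2.
dfact : ℕ → ℕ
dfact zero = 1
dfact (suc zero) = 1
dfact (suc (suc k)) = suc (suc k) * dfact k

-- maximum / minimum of a function Fin n → ℕ (value 0 when n = 0)
maxᶠ : ∀ {n} → (Fin n → ℕ) → ℕ
maxᶠ {zero} f = 0
maxᶠ {suc n} f = f F.zero ⊔ maxᶠ (λ i → f (F.suc i))

minᶠ : ∀ {n} → (Fin n → ℕ) → ℕ
minᶠ {zero} f = 0
minᶠ {suc zero} f = f F.zero
minᶠ {suc (suc n)} f = f F.zero ⊓ minᶠ (λ i → f (F.suc i))

module _ {c ℓ : Level} (G : AbelianGroup c ℓ) where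
  open AbelianGroup G

  subsetSum : ∀ {n} → (Fin n → Carrier) → Subset n → Carrier
  subsetSum {zero} e [] = ε
  subsetSum {suc n} e (false ∷ s) = subsetSum (λ i → e (F.suc i)) s
  subsetSum {suc n} e (true ∷ s) = e F.zero ∙ subsetSum (λ i → e (F.suc i)) s

  countSubsets : ∀ {n} → Decidable _≈_ → (Fin n → Carrier) → ℕ → Carrier → ℕ
  countSubsets {n} _≟_ e h a =
    length (filter (λ s → (∣ s ∣ N.≟ h) ×-dec (subsetSum e s ≟ a)) (allSubsets n))

{-# OPTIONS --safe #-}
-- Write F_m(a) for the number of m-subsets with sum a, D_m = max F_m − min F_m and
-- S_m = D_0 + ⋯ + D_m. Splitting according to whether a subset contains x gives
-- F_{m+1}(a) = A_{m+1}(x, a) + A_m(x, a − x), where A_m(x, ·) counts the m-subsets avoiding x,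
-- so by induction every A_m(x, ·) varies by at most S_m. Counting pairs (x, s) with x ∈ s gives
-- (m+1) F_{m+1}(a) = Σ_x A_m(x, a − x), and Σ_x F_m(a − x) = C(n, m) since every m-subset has
-- exactly one such x. Together
--   (m+2) F_{m+2}(a) = C(n, m+1) − Σ_x A_m(x, a − 2x),   hence   (m+2) D_{m+2} ≤ n S_m.
-- As D_0 ≤ 1 and D_1 = 0, induction gives S_{2k} (2k)!! ≤ (8n/3)^k and S_{2k+1} (2k)!! ≤ 2 (8n/3)^k
-- while 4k ≤ n + 2; raising to the fourth power and using 8⁴ ≤ 2⁶ 3⁴ yields both bounds.

module Submission where

open import Defs
open import Level using (Level)
open import Data.Nat using (ℕ; _+_; _*_; _∸_; _^_; _≤_; _/_)
open import Data.Fin using (Fin)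
open import Algebra.Bundles using (AbelianGroup)
open import Relation.Binary.Definitions using (Decidable)
open import Relation.Binary.PropositionalEquality using (_≡_)
open import Data.Product using (_×_; Σ)

open import Data.Nat using (zero; suc; z≤n; s≤s; NonZero)
open import Algebra.Bundles using (Group)
import Data.Nat as ℕ
open import Data.Nat.Properties
open import Data.Nat.DivMod using (m/n*n≤m)
open import Data.Nat.Tactic.RingSolver using (solve; solve-∀)
import Data.Nat.ListAction as List
import Data.Nat.ListAction.Properties as List
open import Data.Bool using (true; false; if_then_else_)
open import Data.Fin using (zero; suc)
import Data.Fin.Properties as Fin
open import Data.Fin.Subset using (Subset; ∣_∣; inside; outside)
open import Data.List using (List; []; _∷_; map; _++_; length; filter)
open import Data.List.Properties using (map-++; map-∘)
open import Data.Product using (_,_; proj₁; proj₂)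
open import Data.Sum using (inj₁; inj₂)
open import Function using (_∘_; mk⇔)
open import Relation.Binary.PropositionalEquality
  using (_≢_; refl; sym; trans; cong; cong₂; subst; subst₂; _≗_; module ≡-Reasoning)
open import Relation.Nullary using (Dec; yes; no; does; ¬_)
open import Relation.Nullary.Decidable using (_×-dec_; does-⇔; dec-true; dec-false)
open import Relation.Unary using (Pred) renaming (Decidable to Decidable₁)
open import Algebra.Properties.Semiring.Sum +-*-semiring
  using (sum-syntax; sum-cong-≗; sum-replicate-zero; ∑-distrib-+; *-distribˡ-sum)
open import Algebra.Properties.CommutativeSemigroup +-commutativeSemigroup using (interchange)
open import Algebra.Properties.CommutativeSemigroup *-commutativeSemigroup
  using () renaming (interchange to *-interchange)

private
  variable
    a p q : Level
    A : Set a
    P : Set p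
    Q : Set q

𝟙 : Dec P → ℕ
𝟙 P? = if does P? then 1 else 0

𝟙-cong : (P → Q) → (Q → P) → (P? : Dec P) (Q? : Dec Q) → 𝟙 P? ≡ 𝟙 Q?
𝟙-cong P→Q Q→P P? Q? = cong (λ b → if b then 1 else 0) (does-⇔ (mk⇔ P→Q Q→P) P? Q?)

𝟙-yes : (P? : Dec P) → P → 𝟙 P? ≡ 1
𝟙-yes P? p = cong (λ b → if b then 1 else 0) (dec-true P? p)

𝟙-no : (P? : Dec P) → ¬ P → 𝟙 P? ≡ 0
𝟙-no P? ¬p = cong (λ b → if b then 1 else 0) (dec-false P? ¬p)

𝟙≤1 : (P? : Dec P) → 𝟙 P? ≤ 1
𝟙≤1 (yes _) = s≤s z≤n
𝟙≤1 (no _)  = z≤n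

𝟙-×-dec : (P? : Dec P) (Q? : Dec Q) → 𝟙 (P? ×-dec Q?) ≡ 𝟙 P? * 𝟙 Q?
𝟙-×-dec (yes _) (yes _) = refl
𝟙-×-dec (yes _) (no _)  = refl
𝟙-×-dec (no _)  _       = refl

*-𝟙-≡ : ∀ {x y} (x≟y : Dec (x ≡ y)) r → x * (𝟙 x≟y * r) ≡ y * (𝟙 x≟y * r)
*-𝟙-≡ (yes refl) r = refl
*-𝟙-≡ {x} {y} (no _) r = trans (*-zeroʳ x) (sym (*-zeroʳ y))

length-filter≡sum-𝟙 : {P : Pred A p} (P? : Decidable₁ P) (xs : List A) →
                       length (filter P? xs) ≡ List.sum (map (𝟙 ∘ P?) xs)
length-filter≡sum-𝟙 P? [] = refl
length-filter≡sum-𝟙 P? (x ∷ xs) with does (P? x)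
... | true  = cong suc (length-filter≡sum-𝟙 P? xs)
... | false = length-filter≡sum-𝟙 P? xs

∑-𝟙-unique : ∀ {n} {P : Pred (Fin n) p} (P? : Decidable₁ P) {j} →
             P j → (∀ {i} → P i → i ≡ j) → ∑[ i < n ] 𝟙 (P? i) ≡ 1
∑-𝟙-unique {n = suc n} P? {zero} Pj unique =
  cong₂ _+_ (𝟙-yes (P? zero) Pj)
    (trans (sum-cong-≗ (λ i → 𝟙-no (P? (suc i)) (λ P[1+i] → Fin.0≢1+n (sym (unique P[1+i])))))
           (sum-replicate-zero n))
∑-𝟙-unique {n = suc n} P? {suc j} Pj unique =
  cong₂ _+_ (𝟙-no (P? zero) (λ P0 → Fin.0≢1+n (unique P0)))
            (∑-𝟙-unique (P? ∘ suc) Pj (Fin.suc-injective ∘ unique))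

-- Vec's constructors are kept local: were they ambiguous with List's, the variable lists given to
-- the ring-solver macro below would take minutes to elaborate.
module _ where

  open import Data.Vec using ([]; _∷_; lookup; _[_]≔_)

  ∑ˢ : ∀ {n} → (Subset n → ℕ) → ℕ
  ∑ˢ {zero}  w = w []
  ∑ˢ {suc n} w = ∑ˢ (w ∘ (outside ∷_)) + ∑ˢ (w ∘ (inside ∷_))

  ∑ˢ-cong : ∀ {n} {v w : Subset n → ℕ} → v ≗ w → ∑ˢ v ≡ ∑ˢ w
  ∑ˢ-cong {zero}  v≗w = v≗w []
  ∑ˢ-cong {suc n} v≗w = cong₂ _+_ (∑ˢ-cong (v≗w ∘ (outside ∷_))) (∑ˢ-cong (v≗w ∘ (inside ∷_)))

  ∑ˢ-mono : ∀ {n} {v w : Subset n → ℕ} → (∀ s → v s ≤ w s) → ∑ˢ v ≤ ∑ˢ w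
  ∑ˢ-mono {zero}  v≤w = v≤w []
  ∑ˢ-mono {suc n} v≤w = +-mono-≤ (∑ˢ-mono (v≤w ∘ (outside ∷_))) (∑ˢ-mono (v≤w ∘ (inside ∷_)))

  ∑ˢ-zero : ∀ {n} → ∑ˢ {n} (λ _ → 0) ≡ 0
  ∑ˢ-zero {zero}  = refl
  ∑ˢ-zero {suc n} = cong₂ _+_ (∑ˢ-zero {n}) (∑ˢ-zero {n})

  ∑ˢ-distrib-+ : ∀ {n} (v w : Subset n → ℕ) → ∑ˢ (λ s → v s + w s) ≡ ∑ˢ v + ∑ˢ w
  ∑ˢ-distrib-+ {zero}  v w = refl
  ∑ˢ-distrib-+ {suc n} v w =
    trans (cong₂ _+_ (∑ˢ-distrib-+ (v ∘ (outside ∷_)) (w ∘ (outside ∷_)))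
                      (∑ˢ-distrib-+ (v ∘ (inside ∷_)) (w ∘ (inside ∷_))))
          (interchange (∑ˢ (v ∘ (outside ∷_))) (∑ˢ (w ∘ (outside ∷_))) (∑ˢ (v ∘ (inside ∷_))) (∑ˢ (w ∘ (inside ∷_))))

  *-distribˡ-∑ˢ : ∀ {n} c (w : Subset n → ℕ) → c * ∑ˢ w ≡ ∑ˢ (λ s → c * w s)
  *-distribˡ-∑ˢ {zero}  c w = refl
  *-distribˡ-∑ˢ {suc n} c w =
    trans (*-distribˡ-+ c _ _) (cong₂ _+_ (*-distribˡ-∑ˢ c (w ∘ (outside ∷_))) (*-distribˡ-∑ˢ c (w ∘ (inside ∷_))))

  ∑-∑ˢ-comm : ∀ {m n} (w : Fin m → Subset n → ℕ) →
              ∑[ i < m ] ∑ˢ (w i) ≡ ∑ˢ (λ s → ∑[ i < m ] w i s)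
  ∑-∑ˢ-comm {n = zero}  w = refl
  ∑-∑ˢ-comm {n = suc n} w =
    trans (∑-distrib-+ (λ i → ∑ˢ (w i ∘ (outside ∷_))) (λ i → ∑ˢ (w i ∘ (inside ∷_))))
          (cong₂ _+_ (∑-∑ˢ-comm (λ i → w i ∘ (outside ∷_))) (∑-∑ˢ-comm (λ i → w i ∘ (inside ∷_))))

  ∑ˢ-empty : ∀ {n} → ∑ˢ {n} (λ s → 𝟙 (∣ s ∣ ℕ.≟ 0)) ≡ 1
  ∑ˢ-empty {zero}  = refl
  ∑ˢ-empty {suc n} = cong₂ _+_ (∑ˢ-empty {n}) (∑ˢ-zero {n})

  sum-map-allSubsets : ∀ n (w : Subset n → ℕ) → List.sum (map w (allSubsets n)) ≡ ∑ˢ w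
  sum-map-allSubsets zero    w = +-identityʳ (w [])
  sum-map-allSubsets (suc n) w = begin
      List.sum (map w (map (outside ∷_) S ++ map (inside ∷_) S))
    ≡⟨ cong List.sum (map-++ w (map (outside ∷_) S) _) ⟩
      List.sum (map w (map (outside ∷_) S) ++ map w (map (inside ∷_) S))
    ≡⟨ List.sum-++ (map w (map (outside ∷_) S)) _ ⟩
      List.sum (map w (map (outside ∷_) S)) + List.sum (map w (map (inside ∷_) S))
    ≡⟨ cong₂ (λ xs ys → List.sum xs + List.sum ys) (sym (map-∘ S)) (sym (map-∘ S)) ⟩
      List.sum (map (w ∘ (outside ∷_)) S) + List.sum (map (w ∘ (inside ∷_)) S)
    ≡⟨ cong₂ _+_ (sum-map-allSubsets n _) (sum-map-allSubsets n _) ⟩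
      ∑ˢ (w ∘ (outside ∷_)) + ∑ˢ (w ∘ (inside ∷_))
    ∎
    where
    open ≡-Reasoning
    S = allSubsets n

  length-filter-allSubsets : ∀ n {P : Pred (Subset n) p} (P? : Decidable₁ P) →
                             length (filter P? (allSubsets n)) ≡ ∑ˢ (𝟙 ∘ P?)
  length-filter-allSubsets n P? =
    trans (length-filter≡sum-𝟙 P? (allSubsets n)) (sum-map-allSubsets n (𝟙 ∘ P?))

  containing avoiding : ∀ {n} → Fin n → (Subset n → ℕ) → Subset n → ℕ
  containing i w s = if lookup s i then w s else 0
  avoiding   i w s = if lookup s i then 0 else w s

  avoiding-cong : ∀ {n} (i : Fin n) {v w : Subset n → ℕ} →
                  (∀ s → lookup s i ≡ false → v s ≡ w s) → avoiding i v ≗ avoiding i w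
  avoiding-cong i v≡w s with lookup s i in eq
  ... | true  = refl
  ... | false = v≡w s eq

  ∑ˢ-split : ∀ {n} (i : Fin n) (w : Subset n → ℕ) →
             ∑ˢ w ≡ ∑ˢ (avoiding i w) + ∑ˢ (containing i w)
  ∑ˢ-split i w = trans (∑ˢ-cong split) (∑ˢ-distrib-+ (avoiding i w) (containing i w))
    where
    split : ∀ s → w s ≡ avoiding i w s + containing i w s
    split s with lookup s i
    ... | true  = refl
    ... | false = sym (+-identityʳ (w s))

  ∑ˢ-containing : ∀ {n} (i : Fin n) (w : Subset n → ℕ) →
                  ∑ˢ (containing i w) ≡ ∑ˢ (avoiding i (λ s → w (s [ i ]≔ inside)))
  ∑ˢ-containing {suc n} zero    w = +-comm (∑ˢ {n} (λ _ → 0)) _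
  ∑ˢ-containing {suc n} (suc i) w =
    cong₂ _+_ (∑ˢ-containing i (w ∘ (outside ∷_))) (∑ˢ-containing i (w ∘ (inside ∷_)))

  ∑-containing : ∀ {n} (w : Subset n → ℕ) (s : Subset n) →
                 ∑[ i < n ] containing i w s ≡ ∣ s ∣ * w s
  ∑-containing w []            = refl
  ∑-containing w (outside ∷ s) = ∑-containing (w ∘ (outside ∷_)) s
  ∑-containing w (inside ∷ s)  = cong (w (inside ∷ s) +_) (∑-containing (w ∘ (inside ∷_)) s)

  ∣insert∣ : ∀ {n} (s : Subset n) (i : Fin n) → lookup s i ≡ false → ∣ s [ i ]≔ inside ∣ ≡ suc ∣ s ∣
  ∣insert∣ (outside ∷ s) zero    _  = refl
  ∣insert∣ (outside ∷ s) (suc i) eq = ∣insert∣ s i eq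
  ∣insert∣ (inside ∷ s)  (suc i) eq = cong suc (∣insert∣ s i eq)

  lookup⇒∣∣≢0 : ∀ {n} (s : Subset n) (i : Fin n) → lookup s i ≡ true → ∣ s ∣ ≢ 0
  lookup⇒∣∣≢0 (inside ∷ s)  zero    _  ()
  lookup⇒∣∣≢0 (outside ∷ s) (suc i) eq = lookup⇒∣∣≢0 s i eq
  lookup⇒∣∣≢0 (inside ∷ s)  (suc i) _  ()

SpreadAtMost : ℕ → (A → ℕ) → Set _
SpreadAtMost d f = ∀ x y → f x ≤ f y + d

spread-sub : ∀ {f g h : A → ℕ} {d d′} → (∀ x → f x + g x ≡ h x) →
             SpreadAtMost d h → SpreadAtMost d′ g → SpreadAtMost (d′ + d) f
spread-sub {f = f} {g} {h} {d} {d′} f+g≡h h-spread g-spread x y = +-cancelʳ-≤ (g x) (f x) _ (begin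
  f x + g x            ≡⟨ f+g≡h x ⟩
  h x                  ≤⟨ h-spread x y ⟩
  h y + d              ≡⟨ cong (_+ d) (f+g≡h y) ⟨
  f y + g y + d        ≤⟨ +-monoˡ-≤ d (+-monoʳ-≤ (f y) (g-spread y x)) ⟩
  f y + (g x + d′) + d ≡⟨ rearrange (f y) (g x) d′ d ⟩
  f y + (d′ + d) + g x ∎)
  where
  open ≤-Reasoning
  rearrange : ∀ a b c d → a + (b + c) + d ≡ a + (c + d) + b
  rearrange = solve-∀

spread-complement : ∀ {f g : A → ℕ} {c d} → (∀ x → f x + g x ≡ c) →
                    SpreadAtMost d g → SpreadAtMost d f
spread-complement {f = f} {d = d} f+g≡c g-spread x y =
  subst (λ e → f x ≤ f y + e) (+-identityʳ d) (spread-sub f+g≡c (λ _ _ → m≤m+n _ 0) g-spread x y)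

spread-∑ : ∀ {n} {f : Fin n → A → ℕ} {d} → (∀ i → SpreadAtMost d (f i)) →
           SpreadAtMost (n * d) (λ x → ∑[ i < n ] f i x)
spread-∑ {n = zero}  _        _ _ = z≤n
spread-∑ {n = suc n} {f} {d} f-spread x y = begin
  f zero x + ∑[ i < n ] f (suc i) x         ≤⟨ +-mono-≤ (f-spread zero x y) (spread-∑ (f-spread ∘ suc) x y) ⟩
  f zero y + d + (∑[ i < n ] f (suc i) y + n * d)
    ≡⟨ interchange (f zero y) d (∑[ i < n ] f (suc i) y) (n * d) ⟩
  f zero y + ∑[ i < n ] f (suc i) y + (d + n * d) ∎
  where open ≤-Reasoning

maxᶠ-upper : ∀ {n} (f : Fin n → ℕ) i → f i ≤ maxᶠ f
maxᶠ-upper {suc n} f zero    = m≤m⊔n _ _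
maxᶠ-upper {suc n} f (suc i) = ≤-trans (maxᶠ-upper (f ∘ suc) i) (m≤n⊔m _ _)

maxᶠ-lub : ∀ {n} (f : Fin n → ℕ) {c} → (∀ i → f i ≤ c) → maxᶠ f ≤ c
maxᶠ-lub {zero}  f _   = z≤n
maxᶠ-lub {suc n} f f≤c = ⊔-lub (f≤c zero) (maxᶠ-lub (f ∘ suc) (f≤c ∘ suc))

minᶠ-lower : ∀ {n} (f : Fin n → ℕ) i → minᶠ f ≤ f i
minᶠ-lower {suc zero}    f zero    = ≤-refl
minᶠ-lower {suc (suc n)} f zero    = m⊓n≤m _ _
minᶠ-lower {suc (suc n)} f (suc i) = ≤-trans (m⊓n≤n _ _) (minᶠ-lower (f ∘ suc) i)

maxᶠ-attained : ∀ {n} (f : Fin (suc n) → ℕ) → Σ (Fin (suc n)) (λ i → maxᶠ f ≡ f i)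
maxᶠ-attained {zero}  f = zero , ⊔-identityʳ (f zero)
maxᶠ-attained {suc n} f with ⊔-sel (f zero) (maxᶠ (f ∘ suc)) | maxᶠ-attained (f ∘ suc)
... | inj₁ max≡f0 | _           = zero , max≡f0
... | inj₂ max≡mt | i , mt≡fsi  = suc i , trans max≡mt mt≡fsi

minᶠ-attained : ∀ {n} (f : Fin (suc n) → ℕ) → Σ (Fin (suc n)) (λ i → minᶠ f ≡ f i)
minᶠ-attained {zero}  f = zero , refl
minᶠ-attained {suc n} f with ⊓-sel (f zero) (minᶠ (f ∘ suc)) | minᶠ-attained (f ∘ suc)
... | inj₁ min≡f0 | _           = zero , min≡f0
... | inj₂ min≡mt | i , mt≡fsi  = suc i , trans min≡mt mt≡fsi

spread-max∸min : ∀ {n} (f : Fin n → ℕ) → SpreadAtMost (maxᶠ f ∸ minᶠ f) f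
spread-max∸min f i j = begin
  f i                           ≤⟨ maxᶠ-upper f i ⟩
  maxᶠ f                        ≤⟨ m≤n+m∸n (maxᶠ f) (minᶠ f) ⟩
  minᶠ f + (maxᶠ f ∸ minᶠ f)    ≤⟨ +-monoˡ-≤ _ (minᶠ-lower f j) ⟩
  f j + (maxᶠ f ∸ minᶠ f)       ∎
  where open ≤-Reasoning

max∸min-bound : ∀ {n} (f : Fin n → ℕ) c {d} → SpreadAtMost d (λ i → c * f i) → c * (maxᶠ f ∸ minᶠ f) ≤ d
max∸min-bound {zero}  f c _ = ≤-trans (≤-reflexive (*-zeroʳ c)) z≤n
max∸min-bound {suc n} f c {d} spread with maxᶠ-attained f | minᶠ-attained f
... | i , max≡fi | j , min≡fj = begin
  c * (maxᶠ f ∸ minᶠ f) ≡⟨ cong₂ (λ u v → c * (u ∸ v)) max≡fi min≡fj ⟩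
  c * (f i ∸ f j)       ≡⟨ *-distribˡ-∸ c (f i) (f j) ⟩
  c * f i ∸ c * f j     ≤⟨ m≤n+o⇒m∸n≤o (c * f i) (c * f j) (spread i j) ⟩
  d                     ∎
  where open ≤-Reasoning

^-distribʳ-* : ∀ a b k → (a * b) ^ k ≡ a ^ k * b ^ k
^-distribʳ-* a b zero    = refl
^-distribʳ-* a b (suc k) = trans (cong (a * b *_) (^-distribʳ-* a b k)) (*-interchange a b (a ^ k) (b ^ k))

^-^-comm : ∀ a m k → (a ^ m) ^ k ≡ (a ^ k) ^ m
^-^-comm a m k = trans (^-*-assoc a m k) (trans (cong (a ^_) (*-comm m k)) (sym (^-*-assoc a k m)))

^-cancel-bound : ∀ {y a b c} p .{{_ : NonZero a}} → y * a ≤ b → b ^ p ≤ c * a ^ p → y ^ p ≤ c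
^-cancel-bound {y} {a} {b} {c} p ya≤b bᵖ≤caᵖ = *-cancelʳ-≤ (y ^ p) c (a ^ p) {{m^n≢0 a p}} (begin
  y ^ p * a ^ p ≡⟨ ^-distribʳ-* y a p ⟨
  (y * a) ^ p   ≤⟨ ^-monoˡ-≤ p ya≤b ⟩
  b ^ p         ≤⟨ bᵖ≤caᵖ ⟩
  c * a ^ p     ∎)
  where open ≤-Reasoning

-- 8⁴ = 4096 ≤ 5184 = 2⁶·3⁴: the source of the factor 2^{3h/4}.
8ᵏ-bound : ∀ k → (8 ^ k) ^ 4 ≤ 2 ^ (3 * (2 * k)) * (3 ^ k) ^ 4
8ᵏ-bound k = begin
  (8 ^ k) ^ 4                     ≡⟨ ^-^-comm 8 k 4 ⟩
  4096 ^ k                        ≤⟨ ^-monoˡ-≤ k (m≤m+n 4096 1088) ⟩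
  (64 * 81) ^ k                   ≡⟨ ^-distribʳ-* 64 81 k ⟩
  64 ^ k * 81 ^ k                 ≡⟨ cong₂ _*_ (trans (^-*-assoc 2 6 k) (cong (2 ^_) (*-assoc 3 2 k)))
                                               (^-^-comm 3 4 k) ⟩
  2 ^ (3 * (2 * k)) * (3 ^ k) ^ 4 ∎
  where open ≤-Reasoning

fourth-power-bound : ∀ n c k Y → Y * 3 ^ k ≤ c * (8 * n) ^ k →
                     Y ^ 4 ≤ c ^ 4 * (2 ^ (3 * (2 * k)) * n ^ (2 * (2 * k)))
fourth-power-bound n c k Y bound = ^-cancel-bound {y = Y} 4 {{m^n≢0 3 k}} bound (begin
  (c * (8 * n) ^ k) ^ 4                                     ≡⟨ cong (λ x → (c * x) ^ 4) (^-distribʳ-* 8 n k) ⟩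
  (c * (8 ^ k * n ^ k)) ^ 4                                 ≡⟨ trans (^-distribʳ-* c _ 4)
                                                                     (cong (c ^ 4 *_) (^-distribʳ-* (8 ^ k) (n ^ k) 4)) ⟩
  c ^ 4 * ((8 ^ k) ^ 4 * (n ^ k) ^ 4)                       ≤⟨ *-monoʳ-≤ (c ^ 4) (*-monoˡ-≤ ((n ^ k) ^ 4) (8ᵏ-bound k)) ⟩
  c ^ 4 * (2 ^ (3 * (2 * k)) * (3 ^ k) ^ 4 * (n ^ k) ^ 4)   ≡⟨ regroup (c ^ 4) (2 ^ (3 * (2 * k))) ((3 ^ k) ^ 4) ((n ^ k) ^ 4) ⟩
  c ^ 4 * (2 ^ (3 * (2 * k)) * (n ^ k) ^ 4) * (3 ^ k) ^ 4   ≡⟨ cong (λ x → c ^ 4 * (2 ^ (3 * (2 * k)) * x) * (3 ^ k) ^ 4) nᵏ⁴ ⟩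
  c ^ 4 * (2 ^ (3 * (2 * k)) * n ^ (2 * (2 * k))) * (3 ^ k) ^ 4 ∎)
  where
  open ≤-Reasoning
  regroup : ∀ a b c d → a * (b * c * d) ≡ a * (b * d) * c
  regroup = solve-∀
  nᵏ⁴ : (n ^ k) ^ 4 ≡ n ^ (2 * (2 * k))
  nᵏ⁴ = trans (^-^-comm n k 4) (trans (^-*-assoc n 4 k) (cong (n ^_) (*-assoc 2 2 k)))

odd-exponent-bound : ∀ n m → (n * n * 2) ^ 4 * (2 ^ (3 * m) * n ^ (2 * m)) ≤ 2 ^ (3 * (3 + m)) * n ^ (2 * (4 + m))
odd-exponent-bound n m = begin
  (n * n * 2) ^ 4 * (2 ^ (3 * m) * n ^ (2 * m))       ≡⟨ cong (_* (2 ^ (3 * m) * n ^ (2 * m))) (^-distribʳ-* (n * n) 2 4) ⟩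
  (n * n) ^ 4 * 16 * (2 ^ (3 * m) * n ^ (2 * m))      ≡⟨ cong (λ x → x * 16 * (2 ^ (3 * m) * n ^ (2 * m))) (^-distribʳ-* n n 4) ⟩
  n ^ 4 * n ^ 4 * 16 * (2 ^ (3 * m) * n ^ (2 * m))    ≤⟨ *-monoˡ-≤ (2 ^ (3 * m) * n ^ (2 * m)) (*-monoʳ-≤ (n ^ 4 * n ^ 4) (m≤m+n 16 496)) ⟩
  n ^ 4 * n ^ 4 * 512 * (2 ^ (3 * m) * n ^ (2 * m))   ≡⟨ regroup (n ^ 4) (2 ^ (3 * m)) (n ^ (2 * m)) ⟩
  2 ^ 9 * 2 ^ (3 * m) * (n ^ 4 * n ^ 4 * n ^ (2 * m)) ≡⟨ cong₂ _*_ (^-distribˡ-+-* 2 9 (3 * m))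
                                                                   (trans (^-distribˡ-+-* n 8 (2 * m))
                                                                          (cong (_* n ^ (2 * m)) (^-distribˡ-+-* n 4 4))) ⟨
  2 ^ (9 + 3 * m) * n ^ (8 + 2 * m)                   ≡⟨ cong₂ (λ a b → 2 ^ a * n ^ b) (*-distribˡ-+ 3 3 m) (*-distribˡ-+ 2 4 m) ⟨
  2 ^ (3 * (3 + m)) * n ^ (2 * (4 + m))               ∎
  where
  open ≤-Reasoning
  regroup : ∀ x a b → x * x * 512 * (a * b) ≡ 512 * a * (x * x * b)
  regroup = solve-∀

h≤n/2+1⇒2h≤n+2 : ∀ {h} n → h ≤ n / 2 + 1 → 2 * h ≤ n + 2
h≤n/2+1⇒2h≤n+2 {h} n h≤ = begin
  2 * h           ≤⟨ *-monoʳ-≤ 2 h≤ ⟩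
  2 * (n / 2 + 1) ≡⟨ trans (*-distribˡ-+ 2 (n / 2) 1) (cong (_+ 2) (*-comm 2 (n / 2))) ⟩
  n / 2 * 2 + 2   ≤⟨ +-monoˡ-≤ 2 (m/n*n≤m n 2) ⟩
  n + 2           ∎
  where open ≤-Reasoning

partialSum : (ℕ → ℕ) → ℕ → ℕ
partialSum D zero    = D zero
partialSum D (suc m) = partialSum D m + D (suc m)

≤-partialSum : ∀ D m → D m ≤ partialSum D m
≤-partialSum D zero    = ≤-refl
≤-partialSum D (suc m) = m≤n+m (D (suc m)) (partialSum D m)

module PartialSumBound (n : ℕ) (3≤n : 3 ≤ n) (D : ℕ → ℕ) (D₀≤1 : D 0 ≤ 1) (D₁≤1 : D 1 ≤ 1)
  (recurrence : ∀ m → (2 + m) * D (2 + m) ≤ n * partialSum D m) where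

  open ≤-Reasoning

  S : ℕ → ℕ
  S = partialSum D

  step-to-even : ∀ s₀ s₁ d q X t E → s₀ * X * t ≤ E → s₁ * X * t ≤ 2 * E →
                 q * d ≤ n * s₀ → 6 * q ≤ 5 * n → (s₁ + d) * (q * X) * (3 * t) ≤ 8 * n * E
  step-to-even s₀ s₁ d q X t E s₀≤ s₁≤ qd≤ 6q≤ = begin
    (s₁ + d) * (q * X) * (3 * t)                ≡⟨ solve (s₁ ∷ d ∷ q ∷ X ∷ t ∷ []) ⟩
    3 * q * (s₁ * X * t) + 3 * (q * d * X * t)  ≤⟨ +-mono-≤ (*-monoʳ-≤ (3 * q) s₁≤)
                                                            (*-monoʳ-≤ 3 (*-monoˡ-≤ t (*-monoˡ-≤ X qd≤))) ⟩
    3 * q * (2 * E) + 3 * (n * s₀ * X * t)      ≡⟨ solve (q ∷ E ∷ n ∷ s₀ ∷ X ∷ t ∷ []) ⟩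
    6 * q * E + 3 * n * (s₀ * X * t)            ≤⟨ +-mono-≤ (*-monoˡ-≤ E 6q≤) (*-monoʳ-≤ (3 * n) s₀≤) ⟩
    5 * n * E + 3 * n * E                       ≡⟨ solve (n ∷ E ∷ []) ⟩
    8 * n * E                                   ∎

  step-to-odd : ∀ s₁ s₂ d q X t E → s₂ * (q * X) * (3 * t) ≤ 8 * n * E → s₁ * X * t ≤ 2 * E →
                q * d ≤ n * s₁ → (s₂ + d) * (q * X) * (3 * t) ≤ 2 * (8 * n * E)
  step-to-odd s₁ s₂ d q X t E s₂≤ s₁≤ qd≤ = begin
    (s₂ + d) * (q * X) * (3 * t)                    ≡⟨ solve (s₂ ∷ d ∷ q ∷ X ∷ t ∷ []) ⟩
    s₂ * (q * X) * (3 * t) + 3 * (q * d * X * t)    ≤⟨ +-mono-≤ s₂≤ (*-monoʳ-≤ 3 (*-monoˡ-≤ t (*-monoˡ-≤ X qd≤))) ⟩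
    8 * n * E + 3 * (n * s₁ * X * t)                ≡⟨ solve (n ∷ E ∷ s₁ ∷ X ∷ t ∷ []) ⟩
    8 * n * E + 3 * n * (s₁ * X * t)                ≤⟨ +-monoʳ-≤ (8 * n * E) (*-monoʳ-≤ (3 * n) s₁≤) ⟩
    8 * n * E + 3 * n * (2 * E)                     ≤⟨ ≤-reflexive (solve (n ∷ E ∷ [])) ⟩
    8 * n * E + 6 * (n * E)                         ≤⟨ +-monoʳ-≤ (8 * n * E) (*-monoˡ-≤ (n * E) (m≤m+n 6 2)) ⟩
    8 * n * E + 8 * (n * E)                         ≡⟨ solve (n ∷ E ∷ []) ⟩
    2 * (8 * n * E)                                 ∎

  room-for-step : ∀ k → 2 * (2 * suc k) ≤ n + 2 → 6 * (2 + 2 * k) ≤ 5 * n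
  room-for-step k room = begin
    6 * (2 + 2 * k)          ≡⟨ solve (k ∷ []) ⟩
    3 * (2 * (2 * (1 + k)))  ≤⟨ *-monoʳ-≤ 3 room ⟩
    3 * (n + 2)              ≡⟨ solve (n ∷ []) ⟩
    3 * n + 2 * 3            ≤⟨ +-monoʳ-≤ (3 * n) (*-monoʳ-≤ 2 3≤n) ⟩
    3 * n + 2 * n            ≡⟨ solve (n ∷ []) ⟩
    5 * n                    ∎

  -- S_m · m!! ≤ (8n/3)^k for m = 2k (and twice that for S_{m+1}), with the factor 3^k cleared.
  DoubledBound : ℕ → ℕ → Set
  DoubledBound k m = S m * dfact m * 3 ^ k ≤ (8 * n) ^ k
                   × S (1 + m) * dfact m * 3 ^ k ≤ 2 * (8 * n) ^ k

  doubled-bound : ∀ k → 2 * (2 * k) ≤ n + 2 → DoubledBound k (2 * k)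
  doubled-bound zero _ = subst (_≤ 1) (sym (times-one (D 0))) D₀≤1
                       , subst (_≤ 2) (sym (times-one (D 0 + D 1))) (+-mono-≤ D₀≤1 D₁≤1)
    where
    times-one : ∀ x → x * 1 * 1 ≡ x
    times-one = solve-∀
  doubled-bound (suc k) room = subst (DoubledBound (suc k)) (sym (*-suc 2 k)) (even , odd)
    where
    m = 2 * k
    ih = doubled-bound k (≤-trans (*-monoʳ-≤ 2 (*-monoʳ-≤ 2 (n≤1+n k))) room)
    even = step-to-even (S m) (S (1 + m)) (D (2 + m)) (2 + m) (dfact m) (3 ^ k) ((8 * n) ^ k)
                        (proj₁ ih) (proj₂ ih) (recurrence m) (room-for-step k room)
    odd = step-to-odd (S (1 + m)) (S (2 + m)) (D (3 + m)) (2 + m) (dfact m) (3 ^ k) ((8 * n) ^ k)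
                      even (proj₂ ih) (≤-trans (*-monoˡ-≤ (D (3 + m)) (n≤1+n (2 + m))) (recurrence (1 + m)))

  even-bound : ∀ k → 2 * (2 * k) ≤ n + 2 →
               (D (2 * k) * dfact (2 * k)) ^ 4 ≤ 2 ^ (3 * (2 * k)) * n ^ (2 * (2 * k))
  even-bound k room = ≤-trans (fourth-power-bound n 1 k (D (2 * k) * dfact (2 * k)) (begin
    D (2 * k) * dfact (2 * k) * 3 ^ k  ≤⟨ *-monoˡ-≤ (3 ^ k) (*-monoˡ-≤ (dfact (2 * k)) (≤-partialSum D (2 * k))) ⟩
    S (2 * k) * dfact (2 * k) * 3 ^ k  ≤⟨ proj₁ (doubled-bound k room) ⟩
    (8 * n) ^ k                        ≡⟨ *-identityˡ _ ⟨
    1 * (8 * n) ^ k                    ∎))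
    (≤-reflexive (*-identityˡ _))

  odd-product-bound : ∀ j → 2 * (3 + 2 * j) ≤ n + 2 →
                      D (3 + 2 * j) * dfact (4 + 2 * j) * 3 ^ j ≤ n * n * 2 * (8 * n) ^ j
  odd-product-bound j room = begin
    D (3 + m) * ((4 + m) * ((2 + m) * dfact m)) * 3 ^ j  ≡⟨ regroup (D (3 + m)) (4 + m) (2 + m) (dfact m) (3 ^ j) ⟩
    (4 + m) * ((2 + m) * D (3 + m)) * (dfact m * 3 ^ j)  ≤⟨ *-monoˡ-≤ (dfact m * 3 ^ j) (*-mono-≤ 4+m≤n (≤-trans
                                                              (*-monoˡ-≤ (D (3 + m)) (n≤1+n (2 + m))) (recurrence (1 + m)))) ⟩
    n * (n * S (1 + m)) * (dfact m * 3 ^ j)              ≡⟨ regroup′ n (S (1 + m)) (dfact m) (3 ^ j) ⟩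
    n * n * (S (1 + m) * dfact m * 3 ^ j)                ≤⟨ *-monoʳ-≤ (n * n) (proj₂ (doubled-bound j
                                                              (≤-trans (*-monoʳ-≤ 2 (m≤n+m m 3)) room))) ⟩
    n * n * (2 * (8 * n) ^ j)                            ≡⟨ *-assoc (n * n) 2 _ ⟨
    n * n * 2 * (8 * n) ^ j                              ∎
    where
    m = 2 * j
    regroup : ∀ d a b x t → d * (a * (b * x)) * t ≡ a * (b * d) * (x * t)
    regroup = solve-∀
    regroup′ : ∀ n s x t → n * (n * s) * (x * t) ≡ n * n * (s * x * t)
    regroup′ = solve-∀
    4+m≤n : 4 + m ≤ n
    4+m≤n = +-cancelʳ-≤ 2 (4 + m) n (begin
      4 + 2 * j + 2        ≡⟨ solve (j ∷ []) ⟩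
      6 + 2 * j            ≤⟨ m≤m+n (6 + m) m ⟩
      6 + 2 * j + 2 * j    ≡⟨ solve (j ∷ []) ⟩
      2 * (3 + 2 * j)      ≤⟨ room ⟩
      n + 2                ∎)

  odd-bound : ∀ j → 2 * (3 + 2 * j) ≤ n + 2 →
              (D (3 + 2 * j) * dfact (4 + 2 * j)) ^ 4 ≤ 2 ^ (3 * (3 + 2 * j)) * n ^ (2 * (4 + 2 * j))
  odd-bound j room =
    ≤-trans (fourth-power-bound n (n * n * 2) j (D (3 + 2 * j) * dfact (4 + 2 * j)) (odd-product-bound j room))
            (odd-exponent-bound n (2 * j))

  even-case : ∀ h → 2 * h ≤ n + 2 → ∀ k → h ≡ 2 * k →
              (D h * dfact h) ^ 4 ≤ 2 ^ (3 * h) * n ^ (2 * h)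
  even-case .(2 * k) room k refl = even-bound k room

  odd-case : ∀ h → 2 ≤ h → 2 * h ≤ n + 2 → ∀ k → h ≡ 2 * k + 1 →
             (D h * dfact (h + 1)) ^ 4 ≤ 2 ^ (3 * h) * n ^ (2 * (h + 1))
  odd-case .(2 * zero + 1)  (s≤s ())  _    zero    refl
  odd-case .(2 * suc j + 1) _         room (suc j) refl =
    subst₂ (λ h h′ → (D h * dfact h′) ^ 4 ≤ 2 ^ (3 * h) * n ^ (2 * h′)) (sym h≡) (sym h+1≡)
           (odd-bound j (subst (λ h → 2 * h ≤ n + 2) h≡ room))
    where
    h≡ : 2 * suc j + 1 ≡ 3 + 2 * j
    h≡ = solve (j ∷ [])
    h+1≡ : 2 * suc j + 1 + 1 ≡ 4 + 2 * j
    h+1≡ = solve (j ∷ [])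

module AbelianGroupSubsetSums {c ℓ} (G : AbelianGroup c ℓ) where

  open AbelianGroup G using (Carrier; _≈_; _∙_; comm; ∙-congˡ; ∙-congʳ; group; commutativeSemigroup)
    renaming (refl to ≈-refl; trans to ≈-trans)
  open Group group using (_//_)
  open import Algebra.Properties.Group group using (//-rightDividesˡ; quasigroup)
  open import Algebra.Properties.Quasigroup quasigroup using (x≈z//y)
  open import Algebra.Properties.CommutativeSemigroup commutativeSemigroup using (x∙yz≈y∙xz)
  open import Data.Vec using (_∷_; lookup; _[_]≔_)

  ∙≈⇒≈// : ∀ {x y a} → x ∙ y ≈ a → y ≈ a // x
  ∙≈⇒≈// {x} {y} {a} xy≈a = x≈z//y y x a (≈-trans (comm y x) xy≈a)

  ≈//⇒∙≈ : ∀ {x y a} → y ≈ a // x → x ∙ y ≈ a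
  ≈//⇒∙≈ {x} {y} {a} y≈a//x = ≈-trans (comm x y) (≈-trans (∙-congʳ y≈a//x) (//-rightDividesˡ x a))

  ≈//-swap : ∀ {x y a} → y ≈ a // x → x ≈ a // y
  ≈//-swap y≈a//x = ∙≈⇒≈// (≈-trans (comm _ _) (≈//⇒∙≈ y≈a//x))

  subsetSum-insert : ∀ {n} (e : Fin n → Carrier) (s : Subset n) (i : Fin n) → lookup s i ≡ false →
                     subsetSum G e (s [ i ]≔ inside) ≈ e i ∙ subsetSum G e s
  subsetSum-insert e (outside ∷ s) zero    _  = ≈-refl
  subsetSum-insert e (outside ∷ s) (suc i) eq = subsetSum-insert (e ∘ suc) s i eq
  subsetSum-insert e (inside ∷ s)  (suc i) eq =
    ≈-trans (∙-congˡ (subsetSum-insert (e ∘ suc) s i eq)) (x∙yz≈y∙xz _ _ _)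

module SubsetCounting {c ℓ} (G : AbelianGroup c ℓ) {n : ℕ}
  (e : Fin n → AbelianGroup.Carrier G) (_≟_ : Decidable (AbelianGroup._≈_ G)) where

  open AbelianGroup G using (Carrier; _≈_; group)
    renaming (sym to ≈-sym; trans to ≈-trans)
  -- G is written multiplicatively: `a // x` is the paper's a − x.
  open Group group using (_//_)
  open AbelianGroupSubsetSums G
  open import Data.Vec using (lookup; _[_]≔_)

  hits : ℕ → Carrier → Subset n → ℕ
  hits m a s = 𝟙 (∣ s ∣ ℕ.≟ m) * 𝟙 (subsetSum G e s ≟ a)

  count : ℕ → Carrier → ℕ
  count = countSubsets G _≟_ e

  countAvoiding : ℕ → Fin n → Carrier → ℕ
  countAvoiding m i a = ∑ˢ (avoiding i (hits m a))

  numSubsets : ℕ → ℕ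
  numSubsets m = ∑ˢ {n} (λ s → 𝟙 (∣ s ∣ ℕ.≟ m))

  count≡∑ˢ : ∀ m a → count m a ≡ ∑ˢ (hits m a)
  count≡∑ˢ m a = trans (length-filter-allSubsets n _)
                       (∑ˢ-cong (λ s → 𝟙-×-dec (∣ s ∣ ℕ.≟ m) (subsetSum G e s ≟ a)))

  count-cong : ∀ m {a b} → a ≈ b → count m a ≡ count m b
  count-cong m {a} {b} a≈b = begin
    count m a       ≡⟨ count≡∑ˢ m a ⟩
    ∑ˢ (hits m a)   ≡⟨ ∑ˢ-cong (λ s → cong (𝟙 (∣ s ∣ ℕ.≟ m) *_)
                          (𝟙-cong (λ p → ≈-trans p a≈b) (λ p → ≈-trans p (≈-sym a≈b))
                                  (subsetSum G e s ≟ a) (subsetSum G e s ≟ b))) ⟩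
    ∑ˢ (hits m b)   ≡⟨ count≡∑ˢ m b ⟨
    count m b       ∎
    where open ≡-Reasoning

  count-zero≤1 : ∀ a → count 0 a ≤ 1
  count-zero≤1 a = begin
    count 0 a                       ≡⟨ count≡∑ˢ 0 a ⟩
    ∑ˢ (hits 0 a)                   ≤⟨ ∑ˢ-mono hits≤ ⟩
    numSubsets 0                    ≡⟨ ∑ˢ-empty {n} ⟩
    1                               ∎
    where
    open ≤-Reasoning
    hits≤ : ∀ s → hits 0 a s ≤ 𝟙 (∣ s ∣ ℕ.≟ 0)
    hits≤ s = ≤-trans (*-monoʳ-≤ (𝟙 (∣ s ∣ ℕ.≟ 0)) (𝟙≤1 (subsetSum G e s ≟ a))) (≤-reflexive (*-identityʳ _))

  hits-insert : ∀ m a (s : Subset n) i → lookup s i ≡ false →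
                hits (suc m) a (s [ i ]≔ inside) ≡ hits m (a // e i) s
  hits-insert m a s i i∉s = cong₂ _*_
    (𝟙-cong (λ p → suc-injective (trans (sym (∣insert∣ s i i∉s)) p))
            (λ p → trans (∣insert∣ s i i∉s) (cong suc p))
            (∣ s [ i ]≔ inside ∣ ℕ.≟ suc m) (∣ s ∣ ℕ.≟ m))
    (𝟙-cong (λ p → ∙≈⇒≈// (≈-trans (≈-sym (subsetSum-insert e s i i∉s)) p))
            (λ p → ≈-trans (subsetSum-insert e s i i∉s) (≈//⇒∙≈ p))
            (subsetSum G e (s [ i ]≔ inside) ≟ a) (subsetSum G e s ≟ (a // e i)))

  ∑ˢ-containing-hits : ∀ m a i → ∑ˢ (containing i (hits (suc m) a)) ≡ countAvoiding m i (a // e i)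
  ∑ˢ-containing-hits m a i =
    trans (∑ˢ-containing i (hits (suc m) a)) (∑ˢ-cong (avoiding-cong i (λ s → hits-insert m a s i)))

  count-suc-split : ∀ m i a → count (suc m) a ≡ countAvoiding (suc m) i a + countAvoiding m i (a // e i)
  count-suc-split m i a = begin
    count (suc m) a                                                       ≡⟨ count≡∑ˢ (suc m) a ⟩
    ∑ˢ (hits (suc m) a)                                                   ≡⟨ ∑ˢ-split i (hits (suc m) a) ⟩
    countAvoiding (suc m) i a + ∑ˢ (containing i (hits (suc m) a))        ≡⟨ cong (countAvoiding (suc m) i a +_)
                                                                                  (∑ˢ-containing-hits m a i) ⟩
    countAvoiding (suc m) i a + countAvoiding m i (a // e i)              ∎
    where open ≡-Reasoning

  countAvoiding-zero : ∀ i a → countAvoiding 0 i a ≡ count 0 a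
  countAvoiding-zero i a = trans (∑ˢ-cong avoiding≗) (sym (count≡∑ˢ 0 a))
    where
    avoiding≗ : avoiding i (hits 0 a) ≗ hits 0 a
    avoiding≗ s with lookup s i in i∈s
    ... | false = refl
    ... | true  = cong (_* 𝟙 (subsetSum G e s ≟ a)) (sym (𝟙-no (∣ s ∣ ℕ.≟ 0) (lookup⇒∣∣≢0 s i i∈s)))

  suc-*-count : ∀ m a → suc m * count (suc m) a ≡ ∑[ i < n ] countAvoiding m i (a // e i)
  suc-*-count m a = begin
    suc m * count (suc m) a                                ≡⟨ cong (suc m *_) (count≡∑ˢ (suc m) a) ⟩
    suc m * ∑ˢ (hits (suc m) a)                            ≡⟨ *-distribˡ-∑ˢ (suc m) (hits (suc m) a) ⟩
    ∑ˢ (λ s → suc m * hits (suc m) a s)                    ≡⟨ ∑ˢ-cong (λ s → *-𝟙-≡ (∣ s ∣ ℕ.≟ suc m) (𝟙 (subsetSum G e s ≟ a))) ⟨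
    ∑ˢ (λ s → ∣ s ∣ * hits (suc m) a s)                    ≡⟨ ∑ˢ-cong (∑-containing (hits (suc m) a)) ⟨
    ∑ˢ (λ s → ∑[ i < n ] containing i (hits (suc m) a) s)  ≡⟨ ∑-∑ˢ-comm (λ i → containing i (hits (suc m) a)) ⟨
    ∑[ i < n ] ∑ˢ (containing i (hits (suc m) a))          ≡⟨ sum-cong-≗ (∑ˢ-containing-hits m a) ⟩
    ∑[ i < n ] countAvoiding m i (a // e i)                ∎
    where open ≡-Reasoning

  module Bijective (e-injective : ∀ i j → e i ≈ e j → i ≡ j) (e-surjective : ∀ x → Σ (Fin n) (λ i → e i ≈ x)) where

    ∑-hits-translates : ∀ m a s → ∑[ i < n ] hits m (a // e i) s ≡ 𝟙 (∣ s ∣ ℕ.≟ m)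
    ∑-hits-translates m a s = begin
      ∑[ i < n ] (𝟙 (∣ s ∣ ℕ.≟ m) * 𝟙 (subsetSum G e s ≟ (a // e i)))  ≡⟨ *-distribˡ-sum (𝟙 (∣ s ∣ ℕ.≟ m)) (λ i → 𝟙 (subsetSum G e s ≟ (a // e i))) ⟨
      𝟙 (∣ s ∣ ℕ.≟ m) * ∑[ i < n ] 𝟙 (subsetSum G e s ≟ (a // e i))  ≡⟨ cong (𝟙 (∣ s ∣ ℕ.≟ m) *_)
                                                                          (∑-𝟙-unique (λ i → subsetSum G e s ≟ (a // e i))
                                                                                      (≈//-swap (proj₂ j)) unique) ⟩
      𝟙 (∣ s ∣ ℕ.≟ m) * 1                                              ≡⟨ *-identityʳ _ ⟩
      𝟙 (∣ s ∣ ℕ.≟ m)                                                  ∎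
      where
      open ≡-Reasoning
      j = e-surjective (a // subsetSum G e s)
      unique : ∀ {i} → subsetSum G e s ≈ a // e i → i ≡ proj₁ j
      unique s≈a//eᵢ = e-injective _ _ (≈-trans (≈//-swap s≈a//eᵢ) (≈-sym (proj₂ j)))

    ∑-count-translates : ∀ m a → ∑[ i < n ] count m (a // e i) ≡ numSubsets m
    ∑-count-translates m a = begin
      ∑[ i < n ] count m (a // e i)              ≡⟨ sum-cong-≗ (λ i → count≡∑ˢ m (a // e i)) ⟩
      ∑[ i < n ] ∑ˢ (hits m (a // e i))          ≡⟨ ∑-∑ˢ-comm (λ i → hits m (a // e i)) ⟩
      ∑ˢ (λ s → ∑[ i < n ] hits m (a // e i) s)  ≡⟨ ∑ˢ-cong (∑-hits-translates m a) ⟩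
      numSubsets m                               ∎
      where open ≡-Reasoning

    D : ℕ → ℕ
    D m = maxᶠ (λ i → count m (e i)) ∸ minᶠ (λ i → count m (e i))

    count-spread : ∀ m → SpreadAtMost (D m) (count m)
    count-spread m x y =
      subst₂ (λ u v → u ≤ v + D m) (count-cong m (proj₂ (e-surjective x))) (count-cong m (proj₂ (e-surjective y)))
             (spread-max∸min (λ i → count m (e i)) (proj₁ (e-surjective x)) (proj₁ (e-surjective y)))

    countAvoiding-spread : ∀ m i → SpreadAtMost (partialSum D m) (countAvoiding m i)
    countAvoiding-spread zero    i x y =
      subst₂ (λ u v → u ≤ v + D 0) (sym (countAvoiding-zero i x)) (sym (countAvoiding-zero i y)) (count-spread 0 x y)
    countAvoiding-spread (suc m) i =
      spread-sub (λ a → sym (count-suc-split m i a)) (count-spread (suc m))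
                 (λ x y → countAvoiding-spread m i (x // e i) (y // e i))

    D₀≤1 : D 0 ≤ 1
    D₀≤1 = ≤-trans (m∸n≤m _ (minᶠ (λ i → count 0 (e i)))) (maxᶠ-lub (λ i → count 0 (e i)) (λ i → count-zero≤1 (e i)))

    D₁≡0 : D 1 ≡ 0
    D₁≡0 = n≤0⇒n≡0 (subst (_≤ 0) (*-identityˡ (D 1)) (max∸min-bound (λ i → count 1 (e i)) 1 constant))
      where
      count-one : ∀ a → 1 * count 1 a ≡ numSubsets 0
      count-one a = begin
        1 * count 1 a                            ≡⟨ suc-*-count 0 a ⟩
        ∑[ i < n ] countAvoiding 0 i (a // e i)  ≡⟨ sum-cong-≗ (λ i → countAvoiding-zero i (a // e i)) ⟩
        ∑[ i < n ] count 0 (a // e i)            ≡⟨ ∑-count-translates 0 a ⟩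
        numSubsets 0                             ∎
        where open ≡-Reasoning
      constant : SpreadAtMost 0 (λ i → 1 * count 1 (e i))
      constant i j = ≤-reflexive (trans (count-one (e i)) (sym (trans (+-identityʳ _) (count-one (e j)))))

    D-recurrence : ∀ m → (2 + m) * D (2 + m) ≤ n * partialSum D m
    D-recurrence m = max∸min-bound (λ i → count (2 + m) (e i)) (2 + m) (λ i j → scaled-spread (e i) (e j))
      where
      shifted : Carrier → ℕ
      shifted x = ∑[ i < n ] countAvoiding m i (x // e i // e i)
      complement : ∀ x → (2 + m) * count (2 + m) x + shifted x ≡ numSubsets (suc m)
      complement x = begin
        (2 + m) * count (2 + m) x + shifted x
          ≡⟨ cong (_+ shifted x) (suc-*-count (suc m) x) ⟩
        ∑[ i < n ] countAvoiding (suc m) i (x // e i) + shifted x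
          ≡⟨ ∑-distrib-+ (λ i → countAvoiding (suc m) i (x // e i)) (λ i → countAvoiding m i (x // e i // e i)) ⟨
        ∑[ i < n ] (countAvoiding (suc m) i (x // e i) + countAvoiding m i (x // e i // e i))
          ≡⟨ sum-cong-≗ (λ i → count-suc-split m i (x // e i)) ⟨
        ∑[ i < n ] count (suc m) (x // e i)
          ≡⟨ ∑-count-translates (suc m) x ⟩
        numSubsets (suc m) ∎
        where open ≡-Reasoning
      scaled-spread : SpreadAtMost (n * partialSum D m) (λ x → (2 + m) * count (2 + m) x)
      scaled-spread = spread-complement complement
        (spread-∑ (λ i x y → countAvoiding-spread m i (x // e i // e i) (y // e i // e i)))

lemma2 : ∀ {c ℓ : Level} (G : AbelianGroup c ℓ) (n : ℕ)
    (e : Fin n → AbelianGroup.Carrier G)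
    → (∀ i j → AbelianGroup._≈_ G (e i) (e j) → i ≡ j)
    → (∀ x → Σ (Fin n) (λ i → AbelianGroup._≈_ G (e i) x))
    → (_≟_ : Decidable (AbelianGroup._≈_ G))
    → 4 ≤ n
    → (h : ℕ) → 2 ≤ h → h ≤ n / 2 + 1
    → let f = λ (i : Fin n) → countSubsets G _≟_ e h (e i)
          d = maxᶠ f ∸ minᶠ f
      in (∀ k → h ≡ 2 * k → (d * dfact h) ^ 4 ≤ 2 ^ (3 * h) * n ^ (2 * h))
         × (∀ k → h ≡ 2 * k + 1 → (d * dfact (h + 1)) ^ 4 ≤ 2 ^ (3 * h) * n ^ (2 * (h + 1)))
lemma2 G n e e-injective e-surjective _≟_ 4≤n h 2≤h h≤n/2+1 =
  even-case h room , odd-case h 2≤h room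
  where
  open SubsetCounting G e _≟_
  open Bijective e-injective e-surjective
  open PartialSumBound n (≤-trans (n≤1+n 3) 4≤n) D D₀≤1 (≤-trans (≤-reflexive D₁≡0) z≤n) D-recurrence
  room : 2 * h ≤ n + 2
  room = h≤n/2+1⇒2h≤n+2 n h≤n/2+1
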